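{- Let $l,t,s,n$ be integers with $2\le l\le t$, $s\ge l+1\ge 3$ and $n\ge 2\binom{3s}{2}$. Then for every integer $1\le x\le l-1$, $$ex(n,\{K_{l,t},M_{s+1}\},x)\le (l-1)n+ex(2(s-l+1)+1,K_{l,t})-\frac{l(l-1)}{2}.$$
   Context: All graphs are finite, simple and undirected. $ex(m,K_{l,t})$ is the maximum number of edges of an $m$-vertex graph with no $K_{l,t}$ subgraph ($K_{l,t}$: complete bipartite graph with parts of sizes $l,t$); $M_{s+1}$ is a matching of $s+1$ pairwise disjoint edges. For a graph $G$ with matching number at most $s$, let $\mathscr{X}(G)$ be the set of subsets $X\subseteq V(G)$ such that $|X|+\sum_{i=1}^m\lfloor |V(C_i)|/2\rfloor\le s$, where $C_1,\dots,C_m$ are the connected components of $G-X$, and let $x(G)=\max\{|X|: X\in\mathscr{X}(G)\}$. Let $\mathscr{G}_x$ be the set of graphs on $n$ vertices containing neither $K_{l,t}$ nor $M_{s+1}$ as a subgraph and with $x(G)=x$, and $ex(n,\{K_{l,t},M_{s+1}\},x)=\max_{G\in\mathscr{G}_x}e(G)$. -}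

module Defs where

open import Data.Nat using (ℕ; zero; suc; _+_; _*_; _∸_; _≤_; ⌊_/2⌋)
open import Data.Nat.Base using (_<ᵇ_)
open import Data.Bool using (Bool; true; false; _∧_; _∨_; not; if_then_else_)
open import Data.Fin using (Fin; toℕ)
import Data.Fin as Fin
import Data.Nat
open import Data.Empty using (⊥)
open import Data.Fin.Subset using (Subset; ∣_∣)
open import Data.Vec using (lookup)
open import Data.Product using (Σ; _×_; ∃)
open import Relation.Binary.PropositionalEquality using (_≡_; _≢_)
open import Function using (_∘_)

record Graph (n : ℕ) : Set where
  field
    adj    : Fin n → Fin n → Bool
    sym    : ∀ i j → adj i j ≡ adj j i
    irrefl : ∀ i → adj i i ≡ false
open Graph public

sumF : {n : ℕ} → (Fin n → ℕ) → ℕ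
sumF {zero}  f = 0
sumF {suc n} f = f Fin.zero + sumF (f ∘ Fin.suc)

anyF : {n : ℕ} → (Fin n → Bool) → Bool
anyF {zero}  f = false
anyF {suc n} f = f Fin.zero ∨ anyF (f ∘ Fin.suc)

b2n : Bool → ℕ
b2n true  = 1
b2n false = 0

edges : {n : ℕ} → Graph n → ℕ
edges G = sumF λ i → sumF λ j → b2n ((toℕ i <ᵇ toℕ j) ∧ adj G i j)

ContainsK : {n : ℕ} → ℕ → ℕ → Graph n → Set
ContainsK {n} l t G =
  Σ (Fin l → Fin n) λ f → Σ (Fin t → Fin n) λ g →
    (∀ a a' → f a ≡ f a' → a ≡ a') ×
    (∀ b b' → g b ≡ g b' → b ≡ b') ×
    (∀ a b → f a ≢ g b) ×
    (∀ a b → adj G (f a) (g b) ≡ true)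

ContainsM : {n : ℕ} → ℕ → Graph n → Set
ContainsM {n} k G =
  Σ (Fin k → Fin n) λ u → Σ (Fin k → Fin n) λ v →
    (∀ i → adj G (u i) (v i) ≡ true) ×
    (∀ i j → i ≢ j → (u i ≢ u j) × (u i ≢ v j) × (v i ≢ v j))

inX : {n : ℕ} → Subset n → Fin n → Bool
inX X v = lookup X v

adjMinus : {n : ℕ} → Graph n → Subset n → Fin n → Fin n → Bool
adjMinus G X u v = not (inX X u) ∧ not (inX X v) ∧ adj G u v

eqF : {n : ℕ} → Fin n → Fin n → Bool
eqF i j = toℕ i Data.Nat.≡ᵇ toℕ j

walkWithin : {n : ℕ} → Graph n → Subset n → ℕ → Fin n → Fin n → Bool
walkWithin G X zero    u v = eqF u v
walkWithin G X (suc k) u v =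
  walkWithin G X k u v ∨ anyF λ w → walkWithin G X k u w ∧ adjMinus G X w v

-- u and v are in the same connected component of G - X
-- (a walk of length ≤ n suffices on n vertices)
connected : {n : ℕ} → Graph n → Subset n → Fin n → Fin n → Bool
connected {n} G X u v = not (inX X u) ∧ not (inX X v) ∧ walkWithin G X n u v

compSize : {n : ℕ} → Graph n → Subset n → Fin n → ℕ
compSize G X v = sumF λ u → b2n (connected G X v u)

-- v is the least vertex of its component of G - X (one representative per component)
isRep : {n : ℕ} → Graph n → Subset n → Fin n → Bool
isRep G X v = not (inX X v) ∧ not (anyF λ u → (toℕ u <ᵇ toℕ v) ∧ connected G X u v)

-- Σ_{components C of G - X} ⌊|V(C)|/2⌋
halfSum : {n : ℕ} → Graph n → Subset n → ℕ
halfSum G X = sumF λ v → if isRep G X v then ⌊ compSize G X v /2⌋ else 0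

InScrX : {n : ℕ} → ℕ → Graph n → Subset n → Set
InScrX s G X = ∣ X ∣ + halfSum G X ≤ s

HasX : {n : ℕ} → ℕ → Graph n → ℕ → Set
HasX {n} s G x =
  (Σ (Subset n) λ X → InScrX s G X × ∣ X ∣ ≡ x) ×
  (∀ (X : Subset n) → InScrX s G X → ∣ X ∣ ≤ x)

InGx : (n l t s x : ℕ) → Graph n → Set
InGx n l t s x G =
  (ContainsK l t G → ⊥) × (ContainsM (suc s) G → ⊥) × HasX s G x

IsExK : (m l t e : ℕ) → Set
IsExK m l t e =
  (Σ (Graph m) λ H → (ContainsK l t H → ⊥) × edges H ≡ e) ×
  (∀ (H : Graph m) → (ContainsK l t H → ⊥) → edges H ≤ e)

-- Fix X ∈ 𝒳(G) with ∣X∣ = x, so that the components C of G - X satisfy Σ ⌊|C|/2⌋ ≤ s - x.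
-- Identify the least vertices of all components of G - X into a single vertex 0 and keep the
-- remaining vertices of G - X, of which there are at most 2(s - x). In the resulting graph H
-- every edge of G - X survives, injectively: no edge joins two representatives, and an edge is
-- recovered from its non-representative end together with the component it lies in. Moreover,
-- for l, t ≥ 2 every K_{l,t} in H lifts back to G. Counting the edges that meet X gives
--   2 e(G) ≤ x (n - 1) + (n - x) x + 2 e(H).
-- If x = l - 1, then H is a K_{l,t}-free graph on 2(s - l + 1) + 1 vertices, so
-- e(H) ≤ ex(2(s - l + 1) + 1, K_{l,t}) and the bound follows exactly; if x ≤ l - 2, the trivial
-- bound 2 e(H) ≤ (2s + 1)² is absorbed by the spare n, because n ≥ 2 (3s choose 2).

module Submission where

open import Defs
open import Data.Nat
  using (ℕ; zero; suc; _+_; _*_; _∸_; _≤_; _<_; z≤n; s≤s; _≤′_; ≤′-refl; ≤′-step; _<ᵇ_; ⌊_/2⌋; ⌈_/2⌉)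
open import Data.Nat.Properties
open import Data.Nat.Combinatorics using (_C_; nCk+nC[k+1]≡[n+1]C[k+1]; nC1≡n)
open import Data.Nat.Tactic.RingSolver using (solve-∀)
open import Algebra.Properties.CommutativeSemigroup +-commutativeSemigroup using (interchange; xy∙z≈xz∙y)
open import Relation.Binary.Definitions using (tri<; tri≈; tri>)
open import Data.Bool using (Bool; true; false; _∧_; _∨_; not; if_then_else_; T)
open import Data.Bool.Properties using (∧-zeroʳ)
open import Data.Fin as F using (Fin; toℕ)
open import Data.Fin.Properties using (toℕ-injective; any?)
  renaming (suc-injective to fsuc-injective; 0≢1+n to fzero≢fsuc)
open import Data.Fin.Subset using (Subset; ∣_∣)
open import Data.Vec using ([]; _∷_)
open import Data.Product using (Σ; _×_; _,_; proj₁; proj₂)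
open import Data.Sum using (_⊎_; inj₁; inj₂; [_,_])
open import Data.Empty using (⊥; ⊥-elim)
open import Relation.Binary.PropositionalEquality as P using (_≡_; refl; cong; cong₂; subst; _≢_)
open import Relation.Nullary using (¬_; yes; no)
open import Function using (_∘_)

∧-elim : ∀ {a b} → a ∧ b ≡ true → a ≡ true × b ≡ true
∧-elim {true} {true} _ = refl , refl

∧-intro : ∀ {a b} → a ≡ true → b ≡ true → a ∧ b ≡ true
∧-intro refl refl = refl

∨-elim : ∀ {a b} → a ∨ b ≡ true → a ≡ true ⊎ b ≡ true
∨-elim {true} _ = inj₁ refl
∨-elim {false} e = inj₂ e

∨-introˡ : ∀ {a} b → a ≡ true → a ∨ b ≡ true
∨-introˡ b refl = refl

∨-introʳ : ∀ a {b} → b ≡ true → a ∨ b ≡ true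
∨-introʳ true _ = refl
∨-introʳ false e = e

not≡true⇒≡false : ∀ {a} → not a ≡ true → a ≡ false
not≡true⇒≡false {false} _ = refl

≡false⇒not≡true : ∀ {a} → a ≡ false → not a ≡ true
≡false⇒not≡true refl = refl

≡true⇒≢false : ∀ {a} → a ≡ true → a ≢ false
≡true⇒≢false refl ()

≢true⇒≡false : ∀ {a} → a ≢ true → a ≡ false
≢true⇒≡false {true} h = ⊥-elim (h refl)
≢true⇒≡false {false} h = refl

≢false⇒≡true : ∀ {a} → a ≢ false → a ≡ true
≢false⇒≡true {true} h = refl
≢false⇒≡true {false} h = ⊥-elim (h refl)

≡true⊎≡false : ∀ b → b ≡ true ⊎ b ≡ false
≡true⊎≡false true = inj₁ refl
≡true⊎≡false false = inj₂ refl

bool-ext : ∀ {a b} → (a ≡ true → b ≡ true) → (b ≡ true → a ≡ true) → a ≡ b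
bool-ext {true} f g = P.sym (f refl)
bool-ext {false} {true} f g = g refl
bool-ext {false} {false} f g = refl

<ᵇ≡true⇒< : ∀ {m n} → (m <ᵇ n) ≡ true → m < n
<ᵇ≡true⇒< {m} {n} e = <ᵇ⇒< m n (subst T (P.sym e) _)

<⇒<ᵇ≡true : ∀ {m n} → m < n → (m <ᵇ n) ≡ true
<⇒<ᵇ≡true {m} {n} m<n with m <ᵇ n | <⇒<ᵇ m<n
... | true | _ = refl

≮⇒<ᵇ≡false : ∀ {m n} → ¬ (m < n) → (m <ᵇ n) ≡ false
≮⇒<ᵇ≡false h = ≢true⇒≡false (h ∘ <ᵇ≡true⇒<)

eqF≡true⇒≡ : ∀ {n} {i j : Fin n} → eqF i j ≡ true → i ≡ j
eqF≡true⇒≡ {i = i} {j} e = toℕ-injective (≡ᵇ⇒≡ (toℕ i) (toℕ j) (subst T (P.sym e) _))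

≡⇒eqF≡true : ∀ {n} {i j : Fin n} → i ≡ j → eqF i j ≡ true
≡⇒eqF≡true {i = i} refl with eqF i i | ≡⇒≡ᵇ (toℕ i) (toℕ i) refl
... | true | _ = refl

≢⇒eqF≡false : ∀ {n} {i j : Fin n} → i ≢ j → eqF i j ≡ false
≢⇒eqF≡false h = ≢true⇒≡false (h ∘ eqF≡true⇒≡)

sumF-cong : ∀ {n} {f g : Fin n → ℕ} → (∀ i → f i ≡ g i) → sumF f ≡ sumF g
sumF-cong {zero} h = refl
sumF-cong {suc n} h = cong₂ _+_ (h F.zero) (sumF-cong (h ∘ F.suc))

sumF-mono : ∀ {n} {f g : Fin n → ℕ} → (∀ i → f i ≤ g i) → sumF f ≤ sumF g
sumF-mono {zero} h = z≤n
sumF-mono {suc n} h = +-mono-≤ (h F.zero) (sumF-mono (h ∘ F.suc))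

sumF-+ : ∀ {n} (f g : Fin n → ℕ) → sumF (λ i → f i + g i) ≡ sumF f + sumF g
sumF-+ {zero} f g = refl
sumF-+ {suc n} f g =
  P.trans (cong (f F.zero + g F.zero +_) (sumF-+ (f ∘ F.suc) (g ∘ F.suc)))
          (interchange (f F.zero) (g F.zero) _ _)

sumF-const : ∀ {n} c → sumF {n} (λ _ → c) ≡ n * c
sumF-const {zero} c = refl
sumF-const {suc n} c = cong (c +_) (sumF-const {n} c)

sumF-zero : ∀ {n} → sumF {n} (λ _ → 0) ≡ 0
sumF-zero {n} = P.trans (sumF-const {n} 0) (*-zeroʳ n)

sumF-*ˡ : ∀ {n} c (f : Fin n → ℕ) → sumF (λ i → c * f i) ≡ c * sumF f
sumF-*ˡ {zero} c f = P.sym (*-zeroʳ c)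
sumF-*ˡ {suc n} c f =
  P.trans (cong (c * f F.zero +_) (sumF-*ˡ c (f ∘ F.suc))) (P.sym (*-distribˡ-+ c (f F.zero) _))

sumF-*ʳ : ∀ {n} c (f : Fin n → ℕ) → sumF (λ i → f i * c) ≡ sumF f * c
sumF-*ʳ c f = P.trans (sumF-cong (λ i → *-comm (f i) c)) (P.trans (sumF-*ˡ c f) (*-comm c (sumF f)))

sumF-comm : ∀ {n m} (f : Fin n → Fin m → ℕ) →
  sumF (λ i → sumF (λ j → f i j)) ≡ sumF (λ j → sumF (λ i → f i j))
sumF-comm {zero} {m} f = P.sym (sumF-zero {m})
sumF-comm {suc n} {m} f =
  P.trans (cong (sumF (f F.zero) +_) (sumF-comm (f ∘ F.suc)))
          (P.sym (sumF-+ (f F.zero) (λ j → sumF (λ i → f (F.suc i) j))))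

sumF-supported-at : ∀ {n} (f : Fin n → ℕ) i₀ → (∀ i → i ≢ i₀ → f i ≡ 0) → sumF f ≡ f i₀
sumF-supported-at {suc n} f F.zero h =
  P.trans (cong (f F.zero +_) (P.trans (sumF-cong (λ i → h (F.suc i) (λ ()))) (sumF-zero {n})))
          (+-identityʳ _)
sumF-supported-at {suc n} f (F.suc i₀) h =
  P.trans (cong (_+ sumF (f ∘ F.suc)) (h F.zero (λ ())))
          (sumF-supported-at (f ∘ F.suc) i₀ (λ i i≢i₀ → h (F.suc i) (i≢i₀ ∘ fsuc-injective)))

count : ∀ {n} → (Fin n → Bool) → ℕ
count f = sumF (λ i → b2n (f i))

b2n-mono : ∀ a b → (a ≡ true → b ≡ true) → b2n a ≤ b2n b
b2n-mono true b a⇒b rewrite a⇒b refl = ≤-refl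
b2n-mono false b a⇒b = z≤n

b2n≤1 : ∀ b → b2n b ≤ 1
b2n≤1 b = b2n-mono b true (λ _ → refl)

count≤n : ∀ {n} (f : Fin n → Bool) → count f ≤ n
count≤n {zero} f = z≤n
count≤n {suc n} f = +-mono-≤ (b2n≤1 (f F.zero)) (count≤n (f ∘ F.suc))

count-mono : ∀ {n} {f g : Fin n → Bool} → (∀ i → f i ≡ true → g i ≡ true) → count f ≤ count g
count-mono {f = f} {g} f⊆g = sumF-mono λ i → b2n-mono (f i) (g i) (f⊆g i)

count-mono-< : ∀ {n} {f g : Fin n → Bool} → (∀ i → f i ≡ true → g i ≡ true) →
  ∀ i₀ → f i₀ ≡ false → g i₀ ≡ true → count f < count g
count-mono-< {suc n} {f} {g} f⊆g F.zero fi₀ gi₀ rewrite fi₀ | gi₀ = s≤s (count-mono (f⊆g ∘ F.suc))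
count-mono-< {suc n} {f} {g} f⊆g (F.suc i₀) fi₀ gi₀ =
  subst (_≤ b2n (g F.zero) + count (g ∘ F.suc)) (+-suc (b2n (f F.zero)) _)
    (+-mono-≤ (b2n-mono (f F.zero) (g F.zero) (f⊆g F.zero)) (count-mono-< (f⊆g ∘ F.suc) i₀ fi₀ gi₀))

count+count-not : ∀ {n} (f : Fin n → Bool) → count f + count (not ∘ f) ≡ n
count+count-not {zero} f = refl
count+count-not {suc n} f with f F.zero
... | true = cong suc (count+count-not (f ∘ F.suc))
... | false = P.trans (+-suc (count (f ∘ F.suc)) _) (cong suc (count+count-not (f ∘ F.suc)))

count-not : ∀ {n} (f : Fin n → Bool) → count (not ∘ f) ≡ n ∸ count f
count-not {n} f = P.trans (P.sym (m+n∸m≡n (count f) _)) (cong (_∸ count f) (count+count-not f))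

∣X∣≡count : ∀ {n} (X : Subset n) → ∣ X ∣ ≡ count (inX X)
∣X∣≡count [] = refl
∣X∣≡count (true ∷ X) = cong suc (∣X∣≡count X)
∣X∣≡count (false ∷ X) = ∣X∣≡count X

count-const-∧ : ∀ {n} b (f : Fin n → Bool) → count (λ j → b ∧ f j) ≡ b2n b * count f
count-const-∧ true f = P.sym (+-identityʳ _)
count-const-∧ {n} false f = sumF-zero {n}

count-split : ∀ {n} (f q : Fin n → Bool) →
  count f ≡ count (λ j → f j ∧ q j) + count (λ j → f j ∧ not (q j))
count-split f q =
  P.trans (sumF-cong (λ j → split (f j) (q j))) (sumF-+ (λ j → b2n (f j ∧ q j)) (λ j → b2n (f j ∧ not (q j))))
  where
  split : ∀ a b → b2n a ≡ b2n (a ∧ b) + b2n (a ∧ not b)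
  split true true = refl
  split true false = refl
  split false b = refl

anyF-intro : ∀ {n} (f : Fin n → Bool) i → f i ≡ true → anyF f ≡ true
anyF-intro f F.zero e rewrite e = refl
anyF-intro f (F.suc i) e = ∨-introʳ (f F.zero) (anyF-intro (f ∘ F.suc) i e)

anyF-elim : ∀ {n} (f : Fin n → Bool) → anyF f ≡ true → Σ (Fin n) λ i → f i ≡ true
anyF-elim {zero} f ()
anyF-elim {suc n} f e with ∨-elim {f F.zero} e
... | inj₁ f0 = F.zero , f0
... | inj₂ rest with anyF-elim (f ∘ F.suc) rest
... | i , fi = F.suc i , fi

-- Connected components of G - X

module Components {n : ℕ} (G : Graph n) (X : Subset n) where

  W : ℕ → Fin n → Fin n → Bool
  W = walkWithin G X

  adjMinus-sym : ∀ u v → adjMinus G X u v ≡ adjMinus G X v u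
  adjMinus-sym u v with inX X u | inX X v
  ... | true | true = refl
  ... | true | false = refl
  ... | false | true = refl
  ... | false | false = sym G u v

  adjMinus⇒∉X : ∀ {u v} → adjMinus G X u v ≡ true → inX X u ≡ false × inX X v ≡ false
  adjMinus⇒∉X {u} {v} e with ∧-elim {not (inX X u)} e
  ... | u∉X , rest = not≡true⇒≡false u∉X , not≡true⇒≡false (proj₁ (∧-elim {not (inX X v)} rest))

  adjMinus⇒adj : ∀ {u v} → adjMinus G X u v ≡ true → adj G u v ≡ true
  adjMinus⇒adj {u} {v} e = proj₂ (∧-elim {not (inX X v)} (proj₂ (∧-elim {not (inX X u)} e)))

  walk-refl : ∀ k u → W k u u ≡ true
  walk-refl zero u = ≡⇒eqF≡true {i = u} refl
  walk-refl (suc k) u = ∨-introˡ _ (walk-refl k u)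

  walk-suc : ∀ k {u v} → W k u v ≡ true → W (suc k) u v ≡ true
  walk-suc k = ∨-introˡ _

  walk-mono : ∀ {k k' u v} → k ≤ k' → W k u v ≡ true → W k' u v ≡ true
  walk-mono {k} {u = u} {v} k≤k' = go (≤⇒≤′ k≤k')
    where
    go : ∀ {k'} → k ≤′ k' → W k u v ≡ true → W k' u v ≡ true
    go ≤′-refl e = e
    go (≤′-step {n = m} p) e = walk-suc m (go p e)

  walk-snoc : ∀ k {u w v} → W k u w ≡ true → adjMinus G X w v ≡ true → W (suc k) u v ≡ true
  walk-snoc k {u} {w} {v} uw wv =
    ∨-introʳ (W k u v) (anyF-intro (λ w' → W k u w' ∧ adjMinus G X w' v) w (∧-intro uw wv))

  walk-unsnoc : ∀ k {u v} → W (suc k) u v ≡ true →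
    W k u v ≡ true ⊎ Σ (Fin n) λ w → W k u w ≡ true × adjMinus G X w v ≡ true
  walk-unsnoc k {u} {v} e with ∨-elim {W k u v} e
  ... | inj₁ short = inj₁ short
  ... | inj₂ long with anyF-elim (λ w → W k u w ∧ adjMinus G X w v) long
  ... | w , q = inj₂ (w , ∧-elim q)

  walk-zero : ∀ {u v} → W 0 u v ≡ true → u ≡ v
  walk-zero {u} {v} = eqF≡true⇒≡ {i = u} {v}

  walk-++ : ∀ j k {u v w} → W j u v ≡ true → W k v w ≡ true → W (k + j) u w ≡ true
  walk-++ j zero {u} uv vw = subst (λ z → W j u z ≡ true) (walk-zero vw) uv
  walk-++ j (suc k) uv vw with walk-unsnoc k vw
  ... | inj₁ short = walk-suc (k + j) (walk-++ j k uv short)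
  ... | inj₂ (w' , vw' , w'w) = walk-snoc (k + j) (walk-++ j k uv vw') w'w

  walk-sym : ∀ k {u v} → W k u v ≡ true → W k v u ≡ true
  walk-sym zero {u} {v} e = subst (λ z → W 0 z u ≡ true) (walk-zero {u} {v} e) (walk-refl 0 u)
  walk-sym (suc k) {u} {v} e with walk-unsnoc k e
  ... | inj₁ short = walk-suc k (walk-sym k short)
  ... | inj₂ (w , uw , wv) =
    subst (λ z → W z v u ≡ true) (+-comm k 1)
      (walk-++ 1 k {v} {w} {u} (walk-snoc 0 {v} {v} {w} (walk-refl 0 v) (P.trans (adjMinus-sym v w) wv)) (walk-sym k uw))

  -- The sets {v | W k u v} increase strictly in k until they stop changing, and then never
  -- change again; having at most n elements, they are constant from k = n on.

  Stable : Fin n → ℕ → Set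
  Stable u k = ∀ v → W (suc k) u v ≡ true → W k u v ≡ true

  stable-suc : ∀ {u k} → Stable u k → Stable u (suc k)
  stable-suc {u} {k} st v e with walk-unsnoc (suc k) e
  ... | inj₁ short = short
  ... | inj₂ (w , uw , wv) = walk-snoc k (st w uw) wv

  stable-+ : ∀ {u k} → Stable u k → ∀ j → Stable u (j + k)
  stable-+ st zero = st
  stable-+ {u} {k} st (suc j) = stable-suc {u} {j + k} (stable-+ st j)

  stable-shorten : ∀ {u k} → Stable u k → ∀ j v → W (j + k) u v ≡ true → W k u v ≡ true
  stable-shorten st zero v e = e
  stable-shorten st (suc j) v e = stable-shorten st j v (stable-+ st j v e)

  stable-or-growing : ∀ u k → (Σ ℕ λ k' → k' ≤ k × Stable u k') ⊎ (k < count (W k u))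
  stable-or-growing u zero =
    inj₂ (subst (_< count (W 0 u)) (sumF-zero {n})
      (count-mono-< {f = λ _ → false} (λ _ ()) u refl (walk-refl 0 u)))
  stable-or-growing u (suc k) with stable-or-growing u k
  ... | inj₁ (k' , k'≤k , st) = inj₁ (k' , m≤n⇒m≤1+n k'≤k , st)
  ... | inj₂ k<count with anyF (λ v → W (suc k) u v ∧ not (W k u v)) in new
  ... | true with anyF-elim (λ v → W (suc k) u v ∧ not (W k u v)) new
  ... | v , q with ∧-elim q
  ... | long , not-short = inj₂ (≤-trans (s≤s k<count)
          (count-mono-< {f = W k u} {g = W (suc k) u} (λ _ → walk-suc k) v (not≡true⇒≡false not-short) long))
  stable-or-growing u (suc k) | inj₂ _ | false = inj₁ (k , n≤1+n k , st)
    where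
    st : Stable u k
    st v e = ≢false⇒≡true λ short →
      ≡true⇒≢false (anyF-intro _ v (∧-intro e (≡false⇒not≡true short))) new

  stable-at-n : ∀ u → Stable u n
  stable-at-n u with stable-or-growing u n
  ... | inj₂ n<count = ⊥-elim (<-irrefl refl (≤-trans n<count (count≤n (W n u))))
  ... | inj₁ (k' , k'≤n , st) = subst (Stable u) (m∸n+n≡m k'≤n) (stable-+ st (n ∸ k'))

  walk-shorten : ∀ j {u v} → W (j + n) u v ≡ true → W n u v ≡ true
  walk-shorten j {u} {v} = stable-shorten (stable-at-n u) j v

  connected⇒ : ∀ {u v} → connected G X u v ≡ true → inX X u ≡ false × inX X v ≡ false × W n u v ≡ true
  connected⇒ {u} {v} e with ∧-elim {not (inX X u)} e
  ... | u∉X , rest with ∧-elim {not (inX X v)} rest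
  ... | v∉X , uv = not≡true⇒≡false u∉X , not≡true⇒≡false v∉X , uv

  ⇒connected : ∀ {u v} → inX X u ≡ false → inX X v ≡ false → W n u v ≡ true → connected G X u v ≡ true
  ⇒connected u∉X v∉X uv = ∧-intro (≡false⇒not≡true u∉X) (∧-intro (≡false⇒not≡true v∉X) uv)

  connected-refl : ∀ {u} → inX X u ≡ false → connected G X u u ≡ true
  connected-refl u∉X = ⇒connected u∉X u∉X (walk-refl n _)

  connected-sym : ∀ {u v} → connected G X u v ≡ true → connected G X v u ≡ true
  connected-sym e with connected⇒ e
  ... | u∉X , v∉X , uv = ⇒connected v∉X u∉X (walk-sym n uv)

  connected-trans : ∀ {u v w} → connected G X u v ≡ true → connected G X v w ≡ true → connected G X u w ≡ true
  connected-trans e₁ e₂ with connected⇒ e₁ | connected⇒ e₂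
  ... | u∉X , _ , uv | _ , w∉X , vw = ⇒connected u∉X w∉X (walk-shorten n (walk-++ n n uv vw))

  adjMinus⇒connected : ∀ {u v} → adjMinus G X u v ≡ true → connected G X u v ≡ true
  adjMinus⇒connected {u} {v} e with adjMinus⇒∉X e
  ... | u∉X , v∉X = ⇒connected u∉X v∉X (walk-mono {1} (nonZero u) (walk-snoc 0 {u} {u} {v} (walk-refl 0 u) e))
    where
    nonZero : Fin n → 1 ≤ n
    nonZero F.zero = s≤s z≤n
    nonZero (F.suc _) = s≤s z≤n

  ∈X⇒¬connected : ∀ {u v} → inX X v ≡ true → connected G X u v ≡ false
  ∈X⇒¬connected v∈X = ≢true⇒≡false λ c → ≡true⇒≢false v∈X (proj₁ (proj₂ (connected⇒ c)))

module Representatives {n : ℕ} (G : Graph n) (X : Subset n) where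
  open Components G X

  rep : Fin n → Bool
  rep = isRep G X

  nonRep : Fin n → Bool
  nonRep v = not (inX X v) ∧ not (rep v)

  rep-minimal : ∀ {u v} → rep v ≡ true → toℕ u < toℕ v → connected G X u v ≢ true
  rep-minimal {u} {v} e u<v uv =
    ≡true⇒≢false (anyF-intro (λ u → (toℕ u <ᵇ toℕ v) ∧ connected G X u v) u (∧-intro (<⇒<ᵇ≡true u<v) uv))
                 (not≡true⇒≡false (proj₂ (∧-elim {not (inX X v)} e)))

  rep-unique : ∀ {u v} → rep u ≡ true → rep v ≡ true → connected G X u v ≡ true → u ≡ v
  rep-unique {u} {v} ru rv uv with <-cmp (toℕ u) (toℕ v)
  ... | tri< u<v _ _ = ⊥-elim (rep-minimal rv u<v uv)
  ... | tri≈ _ u≡v _ = toℕ-injective u≡v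
  ... | tri> _ _ v<u = ⊥-elim (rep-minimal ru v<u (connected-sym uv))

  nonRep-has-smaller : ∀ {u} → inX X u ≡ false → rep u ≡ false →
    Σ (Fin n) λ u' → toℕ u' < toℕ u × connected G X u' u ≡ true
  nonRep-has-smaller {u} u∉X ru with ≡true⊎≡false (anyF (λ u' → (toℕ u' <ᵇ toℕ u) ∧ connected G X u' u))
  ... | inj₁ some = let u' , q = anyF-elim _ some ; u'<u , u'u = ∧-elim q in u' , <ᵇ≡true⇒< u'<u , u'u
  ... | inj₂ none = ⊥-elim (≡true⇒≢false {rep u} (∧-intro (≡false⇒not≡true u∉X) (≡false⇒not≡true none)) ru)

  rep-exists : ∀ {v} → inX X v ≡ false → Σ (Fin n) λ r → rep r ≡ true × connected G X r v ≡ true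
  rep-exists {v} v∉X = descend (suc (toℕ v)) v ≤-refl (connected-refl v∉X)
    where
    descend : ∀ k u → toℕ u < k → connected G X u v ≡ true →
      Σ (Fin n) λ r → rep r ≡ true × connected G X r v ≡ true
    descend (suc k) u u<k uv with ≡true⊎≡false (rep u)
    ... | inj₁ ru = u , ru , uv
    ... | inj₂ ru with nonRep-has-smaller (proj₁ (connected⇒ uv)) ru
    ... | u' , u'<u , u'u = descend k u' (≤-trans u'<u (≤-pred u<k)) (connected-trans u'u uv)

  count-connected-reps : ∀ v → sumF (λ u → b2n (rep u ∧ connected G X u v)) ≡ b2n (not (inX X v))
  count-connected-reps v with ≡true⊎≡false (inX X v)
  ... | inj₁ v∈X = P.trans (sumF-cong (λ u → cong b2n (P.trans (cong (rep u ∧_) (∈X⇒¬connected v∈X)) (∧-zeroʳ (rep u)))))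
                           (P.trans (sumF-zero {n}) (cong (b2n ∘ not) (P.sym v∈X)))
  ... | inj₂ v∉X with rep-exists v∉X
  ... | r , rr , rv = P.trans (sumF-supported-at _ r others)
                              (P.trans (cong b2n (∧-intro rr rv)) (cong (b2n ∘ not) (P.sym v∉X)))
    where
    others : ∀ u → u ≢ r → b2n (rep u ∧ connected G X u v) ≡ 0
    others u u≢r = cong b2n (≢true⇒≡false λ q →
      let ru , uv = ∧-elim q in u≢r (rep-unique ru rr (connected-trans uv (connected-sym rv))))

  count-∉X : count (not ∘ inX X) ≡ count rep + count nonRep
  count-∉X = P.trans (sumF-cong (λ v → split (inX X v) _)) (sumF-+ (b2n ∘ rep) (b2n ∘ nonRep))
    where
    split : ∀ a q → b2n (not a) ≡ b2n (not a ∧ q) + b2n (not a ∧ not (not a ∧ q))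
    split true q = refl
    split false true = refl
    split false false = refl

  count-nonRep≤2*halfSum : count nonRep ≤ 2 * halfSum G X
  count-nonRep≤2*halfSum = +-cancelˡ-≤ (count rep) _ _ (begin
    count rep + count nonRep
      ≡⟨ P.sym count-∉X ⟩
    count (not ∘ inX X)
      ≡⟨ sumF-cong (λ v → P.sym (count-connected-reps v)) ⟩
    sumF (λ v → sumF (λ u → b2n (rep u ∧ connected G X u v)))
      ≡⟨ sumF-comm (λ v u → b2n (rep u ∧ connected G X u v)) ⟩
    sumF (λ u → count (λ v → rep u ∧ connected G X u v))
      ≡⟨ sumF-cong componentSize ⟩
    sumF (λ u → if rep u then compSize G X u else 0)
      ≤⟨ sumF-mono (λ u → ≤-half (rep u) (compSize G X u)) ⟩
    sumF (λ u → b2n (rep u) + 2 * (if rep u then ⌊ compSize G X u /2⌋ else 0))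
      ≡⟨ sumF-+ (b2n ∘ rep) _ ⟩
    count rep + sumF (λ u → 2 * (if rep u then ⌊ compSize G X u /2⌋ else 0))
      ≡⟨ cong (count rep +_) (sumF-*ˡ 2 (λ u → if rep u then ⌊ compSize G X u /2⌋ else 0)) ⟩
    count rep + 2 * halfSum G X ∎)
    where
    open ≤-Reasoning
    componentSize : ∀ u → count (λ v → rep u ∧ connected G X u v) ≡ (if rep u then compSize G X u else 0)
    componentSize u with rep u
    ... | true = refl
    ... | false = sumF-zero {n}
    m≤1+2*⌊m/2⌋ : ∀ m → m ≤ 1 + 2 * ⌊ m /2⌋
    m≤1+2*⌊m/2⌋ zero = z≤n
    m≤1+2*⌊m/2⌋ (suc zero) = ≤-refl
    m≤1+2*⌊m/2⌋ (suc (suc m)) =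
      subst (λ z → suc (suc m) ≤ 1 + z) (P.sym (*-suc 2 ⌊ m /2⌋)) (s≤s (s≤s (m≤1+2*⌊m/2⌋ m)))
    ≤-half : ∀ r m → (if r then m else 0) ≤ b2n r + 2 * (if r then ⌊ m /2⌋ else 0)
    ≤-half true m = m≤1+2*⌊m/2⌋ m
    ≤-half false m = z≤n

count₂ : ∀ {a b} → (Fin a → Fin b → Bool) → ℕ
count₂ g = sumF (λ i → count (g i))

count₂≤ : ∀ {a b} (g : Fin a → Fin b → Bool) → count₂ g ≤ a * b
count₂≤ {a} {b} g = ≤-trans (sumF-mono (λ i → count≤n (g i))) (≤-reflexive (sumF-const {a} b))

count₂-split : ∀ {a b} (g q : Fin a → Fin b → Bool) →
  count₂ g ≡ count₂ (λ i j → g i j ∧ q i j) + count₂ (λ i j → g i j ∧ not (q i j))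
count₂-split g q = P.trans (sumF-cong (λ i → count-split (g i) (q i)))
  (sumF-+ (λ i → count (λ j → g i j ∧ q i j)) (λ i → count (λ j → g i j ∧ not (q i j))))

without : ∀ {a b} → (Fin a → Fin b → Bool) → Fin a → Fin b → Fin a → Fin b → Bool
without g i₀ j₀ i j = g i j ∧ not (eqF i i₀ ∧ eqF j j₀)

count₂-without : ∀ {a b} (g : Fin a → Fin b → Bool) i₀ j₀ → g i₀ j₀ ≡ true →
  count₂ g ≡ suc (count₂ (without g i₀ j₀))
count₂-without {a} {b} g i₀ j₀ e =
  P.trans (count₂-split g (λ i j → eqF i i₀ ∧ eqF j j₀)) (cong (_+ count₂ (without g i₀ j₀)) single)
  where
  selected : Fin a → Fin b → Bool
  selected i j = g i j ∧ (eqF i i₀ ∧ eqF j j₀)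
  unselected : ∀ {i j} → i ≢ i₀ ⊎ j ≢ j₀ → b2n (selected i j) ≡ 0
  unselected {i} {j} off = cong b2n (≢true⇒≡false λ q →
    let qi , qj = ∧-elim (proj₂ (∧-elim {g i j} q)) in
    [ (λ i≢i₀ → i≢i₀ (eqF≡true⇒≡ qi)) , (λ j≢j₀ → j≢j₀ (eqF≡true⇒≡ qj)) ] off)
  single : count₂ selected ≡ 1
  single = begin
    count₂ selected
      ≡⟨ sumF-supported-at _ i₀ (λ i i≢i₀ →
           P.trans (sumF-cong (λ j → unselected {i} {j} (inj₁ i≢i₀))) (sumF-zero {b})) ⟩
    count (selected i₀)
      ≡⟨ sumF-supported-at _ j₀ (λ j j≢j₀ → unselected (inj₂ j≢j₀)) ⟩
    b2n (selected i₀ j₀)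
      ≡⟨ cong b2n (∧-intro e (∧-intro (≡⇒eqF≡true {i = i₀} refl) (≡⇒eqF≡true {i = j₀} refl))) ⟩
    1 ∎
    where open P.≡-Reasoning

count≤count₂ : ∀ {n a b} (f : Fin n → Bool) (g : Fin a → Fin b → Bool) (h₁ : Fin n → Fin a) (h₂ : Fin n → Fin b) →
  (∀ i → f i ≡ true → g (h₁ i) (h₂ i) ≡ true) →
  (∀ i i' → f i ≡ true → f i' ≡ true → h₁ i ≡ h₁ i' → h₂ i ≡ h₂ i' → i ≡ i') →
  count f ≤ count₂ g
count≤count₂ {zero} f g h₁ h₂ maps inj = z≤n
count≤count₂ {suc n} f g h₁ h₂ maps inj with f F.zero in f0
... | false = count≤count₂ (f ∘ F.suc) g (h₁ ∘ F.suc) (h₂ ∘ F.suc) (maps ∘ F.suc)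
                (λ i i' p q r s → fsuc-injective (inj _ _ p q r s))
... | true = ≤-trans (s≤s (count≤count₂ (f ∘ F.suc) (without g (h₁ F.zero) (h₂ F.zero)) (h₁ ∘ F.suc) (h₂ ∘ F.suc)
                              maps-without (λ i i' p q r s → fsuc-injective (inj _ _ p q r s))))
                     (≤-reflexive (P.sym (count₂-without g (h₁ F.zero) (h₂ F.zero) (maps F.zero f0))))
  where
  maps-without : ∀ i → f (F.suc i) ≡ true → without g (h₁ F.zero) (h₂ F.zero) (h₁ (F.suc i)) (h₂ (F.suc i)) ≡ true
  maps-without i fi = ∧-intro (maps (F.suc i) fi) (≡false⇒not≡true (≢true⇒≡false λ q →
    let e₁ , e₂ = ∧-elim q in fzero≢fsuc (P.sym (inj (F.suc i) F.zero fi f0 (eqF≡true⇒≡ e₁) (eqF≡true⇒≡ e₂)))))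

count₂-mono-injective : ∀ {n m a b} (f : Fin n → Fin m → Bool) (g : Fin a → Fin b → Bool)
  (h₁ : Fin n → Fin m → Fin a) (h₂ : Fin n → Fin m → Fin b) →
  (∀ i j → f i j ≡ true → g (h₁ i j) (h₂ i j) ≡ true) →
  (∀ i j i' j' → f i j ≡ true → f i' j' ≡ true → h₁ i j ≡ h₁ i' j' → h₂ i j ≡ h₂ i' j' → i ≡ i' × j ≡ j') →
  count₂ f ≤ count₂ g
count₂-mono-injective {zero} f g h₁ h₂ maps inj = z≤n
count₂-mono-injective {suc n} f g h₁ h₂ maps inj =
  ≤-trans (+-mono-≤ firstRow otherRows) (≤-reflexive (P.sym (count₂-split g hit)))
  where
  hit : _ → _ → Bool
  hit a b = anyF (λ j → f F.zero j ∧ (eqF (h₁ F.zero j) a ∧ eqF (h₂ F.zero j) b))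
  firstRow : count (f F.zero) ≤ count₂ (λ a b → g a b ∧ hit a b)
  firstRow = count≤count₂ (f F.zero) _ (h₁ F.zero) (h₂ F.zero)
    (λ j fj → ∧-intro (maps F.zero j fj) (anyF-intro _ j
      (∧-intro fj (∧-intro (≡⇒eqF≡true {i = h₁ F.zero j} refl) (≡⇒eqF≡true {i = h₂ F.zero j} refl)))))
    (λ j j' p q r s → proj₂ (inj F.zero j F.zero j' p q r s))
  otherRows : count₂ (f ∘ F.suc) ≤ count₂ (λ a b → g a b ∧ not (hit a b))
  otherRows = count₂-mono-injective (f ∘ F.suc) _ (h₁ ∘ F.suc) (h₂ ∘ F.suc)
    (λ i j fij → ∧-intro (maps (F.suc i) j fij) (≡false⇒not≡true (≢true⇒≡false λ q →
       let j' , q' = anyF-elim _ q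
           f0j' , e = ∧-elim q'
           e₁ , e₂ = ∧-elim e
       in fzero≢fsuc (proj₁ (inj F.zero j' (F.suc i) j f0j' fij (eqF≡true⇒≡ e₁) (eqF≡true⇒≡ e₂))))))
    (λ i j i' j' p q r s → let i≡i' , j≡j' = inj (F.suc i) j (F.suc i') j' p q r s in fsuc-injective i≡i' , j≡j')

count₂-adj≡2*edges : ∀ {n} (G : Graph n) → count₂ (adj G) ≡ 2 * edges G
count₂-adj≡2*edges {n} G = begin
    count₂ (adj G)
      ≡⟨ sumF-cong splitRow ⟩
    sumF (λ i → count (λ j → L i j ∧ adj G i j) + count (λ j → L j i ∧ adj G i j))
      ≡⟨ sumF-+ (λ i → count (λ j → L i j ∧ adj G i j)) (λ i → count (λ j → L j i ∧ adj G i j)) ⟩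
    edges G + sumF (λ i → count (λ j → L j i ∧ adj G i j))
      ≡⟨ cong (edges G +_) (sumF-comm (λ i j → b2n (L j i ∧ adj G i j))) ⟩
    edges G + sumF (λ j → count (λ i → L j i ∧ adj G i j))
      ≡⟨ cong (edges G +_) (sumF-cong (λ j → sumF-cong (λ i → cong (λ z → b2n (L j i ∧ z)) (sym G i j)))) ⟩
    edges G + edges G
      ≡⟨ cong (edges G +_) (P.sym (+-identityʳ (edges G))) ⟩
    2 * edges G ∎
  where
  open P.≡-Reasoning
  L : Fin n → Fin n → Bool
  L i j = toℕ i <ᵇ toℕ j
  byOrder : ∀ i j → b2n (adj G i j) ≡ b2n (L i j ∧ adj G i j) + b2n (L j i ∧ adj G i j)
  byOrder i j with <-cmp (toℕ i) (toℕ j)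
  ... | tri< i<j _ j≮i rewrite <⇒<ᵇ≡true i<j | ≮⇒<ᵇ≡false j≮i = P.sym (+-identityʳ _)
  ... | tri≈ i≮j i≡j _ rewrite toℕ-injective i≡j | irrefl G j | ≮⇒<ᵇ≡false i≮j = refl
  ... | tri> j≮i _ j<i rewrite <⇒<ᵇ≡true j<i | ≮⇒<ᵇ≡false j≮i = refl
  splitRow : ∀ i → count (adj G i) ≡ count (λ j → L i j ∧ adj G i j) + count (λ j → L j i ∧ adj G i j)
  splitRow i = P.trans (sumF-cong (byOrder i)) (sumF-+ (λ j → b2n (L i j ∧ adj G i j)) (λ j → b2n (L j i ∧ adj G i j)))

-- Adjacent ordered pairs (u, v) with u ∈ X number at most ∣X∣ (n - 1), those with u ∉ X, v ∈ X
-- at most (n - ∣X∣) ∣X∣, and all others are adjacent in G - X.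

2*edges≤ : ∀ {n} (G : Graph n) (X : Subset n) →
  2 * edges G ≤ ∣ X ∣ * (n ∸ 1) + (n ∸ ∣ X ∣) * ∣ X ∣ + count₂ (adjMinus G X)
2*edges≤ {n} G X = begin
    2 * edges G
      ≡⟨ P.sym (count₂-adj≡2*edges G) ⟩
    count₂ (adj G)
      ≤⟨ sumF-mono (λ i → sumF-mono (λ j → classify i j)) ⟩
    sumF (λ i → sumF (λ j → b2n (fromX i j) + b2n (intoX i j) + b2n (adjMinus G X i j)))
      ≡⟨ sumF-cong (λ i → P.trans (sumF-+ (λ j → b2n (fromX i j) + b2n (intoX i j)) (λ j → b2n (adjMinus G X i j)))
                                  (cong (_+ count (adjMinus G X i)) (sumF-+ (λ j → b2n (fromX i j)) (λ j → b2n (intoX i j))))) ⟩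
    sumF (λ i → count (fromX i) + count (intoX i) + count (adjMinus G X i))
      ≡⟨ P.trans (sumF-+ (λ i → count (fromX i) + count (intoX i)) (λ i → count (adjMinus G X i)))
                 (cong (_+ count₂ (adjMinus G X)) (sumF-+ (λ i → count (fromX i)) (λ i → count (intoX i)))) ⟩
    count₂ fromX + count₂ intoX + count₂ (adjMinus G X)
      ≡⟨ cong (_+ count₂ (adjMinus G X)) (cong₂ _+_ count₂-fromX count₂-intoX) ⟩
    ∣ X ∣ * (n ∸ 1) + (n ∸ ∣ X ∣) * ∣ X ∣ + count₂ (adjMinus G X) ∎
  where
  open ≤-Reasoning
  fromX intoX : Fin n → Fin n → Bool
  fromX i j = inX X i ∧ not (eqF i j)
  intoX i j = not (inX X i) ∧ inX X j
  adj⇒≢ : ∀ {i j} → adj G i j ≡ true → i ≢ j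
  adj⇒≢ {i} ij refl = ≡true⇒≢false ij (irrefl G i)
  classify : ∀ i j → b2n (adj G i j) ≤ b2n (fromX i j) + b2n (intoX i j) + b2n (adjMinus G X i j)
  classify i j with adj G i j in ij
  ... | false = z≤n
  ... | true with inX X i
  ... | true rewrite ≢⇒eqF≡false (adj⇒≢ ij) = s≤s z≤n
  ... | false with inX X j
  ... | true = s≤s z≤n
  ... | false = s≤s z≤n
  count₂-fromX : count₂ fromX ≡ ∣ X ∣ * (n ∸ 1)
  count₂-fromX = begin-equality
    count₂ fromX
      ≡⟨ sumF-cong (λ i → P.trans (count-const-∧ (inX X i) (not ∘ eqF i)) (cong (b2n (inX X i) *_) (othersCount i))) ⟩
    sumF (λ i → b2n (inX X i) * (n ∸ 1))
      ≡⟨ sumF-*ʳ (n ∸ 1) (b2n ∘ inX X) ⟩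
    count (inX X) * (n ∸ 1)
      ≡⟨ cong (_* (n ∸ 1)) (P.sym (∣X∣≡count X)) ⟩
    ∣ X ∣ * (n ∸ 1) ∎
    where
    othersCount : ∀ i → count (not ∘ eqF i) ≡ n ∸ 1
    othersCount i = P.trans (count-not (eqF i)) (cong (n ∸_)
      (P.trans (sumF-supported-at _ i (λ j j≢i → cong b2n (≢⇒eqF≡false (j≢i ∘ P.sym))))
               (cong b2n (≡⇒eqF≡true {i = i} refl))))
  count₂-intoX : count₂ intoX ≡ (n ∸ ∣ X ∣) * ∣ X ∣
  count₂-intoX = begin-equality
    count₂ intoX
      ≡⟨ sumF-cong (λ i → count-const-∧ (not (inX X i)) (inX X)) ⟩
    sumF (λ i → b2n (not (inX X i)) * count (inX X))
      ≡⟨ sumF-*ʳ (count (inX X)) (b2n ∘ not ∘ inX X) ⟩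
    count (not ∘ inX X) * count (inX X)
      ≡⟨ cong (_* count (inX X)) (count-not (inX X)) ⟩
    (n ∸ count (inX X)) * count (inX X)
      ≡⟨ cong (λ z → (n ∸ z) * z) (P.sym (∣X∣≡count X)) ⟩
    (n ∸ ∣ X ∣) * ∣ X ∣ ∎

-- Compressing G - X

clamp : (m k : ℕ) → Fin (suc m)
clamp zero k = F.zero
clamp (suc m) zero = F.zero
clamp (suc m) (suc k) = F.suc (clamp m k)

toℕ-clamp : ∀ m k → k ≤ m → toℕ (clamp m k) ≡ k
toℕ-clamp zero zero k≤m = refl
toℕ-clamp (suc m) zero k≤m = refl
toℕ-clamp (suc m) (suc k) (s≤s k≤m) = cong suc (toℕ-clamp m k k≤m)

swapK : ∀ {n l t} {G : Graph n} → ContainsK t l G → ContainsK l t G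
swapK {G = G} (f , g , f-inj , g-inj , f≢g , f~g) =
  g , f , g-inj , f-inj , (λ b a e → f≢g a b (P.sym e)) , (λ b a → P.trans (sym G (g b) (f a)) (f~g a b))

module Compression {n : ℕ} (G : Graph n) (X : Subset n) (m : ℕ)
                   (few : count (Representatives.nonRep G X) ≤ m) where
  open Components G X
  open Representatives G X

  below : Fin n → Fin n → Bool
  below v u = (toℕ u <ᵇ toℕ v) ∧ nonRep u

  ¬below-self : ∀ v → below v v ≡ false
  ¬below-self v = cong (_∧ nonRep v) (≮⇒<ᵇ≡false (<-irrefl {toℕ v} refl))

  rank : Fin n → ℕ
  rank v = count (below v)

  rank<count : ∀ {v} → nonRep v ≡ true → rank v < count nonRep
  rank<count {v} nv = count-mono-< (λ u q → proj₂ (∧-elim {toℕ u <ᵇ toℕ v} q)) v (¬below-self v) nv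

  rank-mono-< : ∀ {u v} → nonRep u ≡ true → toℕ u < toℕ v → rank u < rank v
  rank-mono-< {u} {v} nu u<v = count-mono-< {f = below u} {g = below v}
    (λ w q → let w<u , nw = ∧-elim {toℕ w <ᵇ toℕ u} q in ∧-intro (<⇒<ᵇ≡true (<-trans (<ᵇ≡true⇒< w<u) u<v)) nw)
    u (¬below-self u) (∧-intro {toℕ u <ᵇ toℕ v} (<⇒<ᵇ≡true u<v) nu)

  -- φ collapses all component representatives to 0 and numbers the other vertices outside X
  -- consecutively from 1.

  φ : Fin n → Fin (suc m)
  φ v = if nonRep v then clamp m (suc (rank v)) else F.zero

  toℕ-φ-nonRep : ∀ {v} → nonRep v ≡ true → toℕ (φ v) ≡ suc (rank v)
  toℕ-φ-nonRep {v} nv rewrite nv = toℕ-clamp m (suc (rank v)) (≤-trans (rank<count nv) few)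

  φ-¬nonRep : ∀ {v} → nonRep v ≡ false → φ v ≡ F.zero
  φ-¬nonRep {v} nv rewrite nv = refl

  φ-nonRep-≢zero : ∀ {v} → nonRep v ≡ true → φ v ≢ F.zero
  φ-nonRep-≢zero nv φv≡0 = 0≢1+n (P.trans (P.sym (cong toℕ φv≡0)) (toℕ-φ-nonRep nv))

  φ-rank-injective : ∀ {u v} → nonRep u ≡ true → nonRep v ≡ true → φ u ≡ φ v → rank u ≡ rank v
  φ-rank-injective nu nv φu≡φv =
    suc-injective (P.trans (P.sym (toℕ-φ-nonRep nu)) (P.trans (cong toℕ φu≡φv) (toℕ-φ-nonRep nv)))

  φ-injective : ∀ {u v} → nonRep u ≡ true → φ u ≡ φ v → u ≡ v
  φ-injective {u} {v} nu φu≡φv with ≡true⊎≡false (nonRep v)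
  ... | inj₂ ¬nv = ⊥-elim (φ-nonRep-≢zero nu (P.trans φu≡φv (φ-¬nonRep ¬nv)))
  ... | inj₁ nv with <-cmp (toℕ u) (toℕ v)
  ... | tri≈ _ u≡v _ = toℕ-injective u≡v
  ... | tri< u<v _ _ = ⊥-elim (<-irrefl (φ-rank-injective nu nv φu≡φv) (rank-mono-< nu u<v))
  ... | tri> _ _ v<u = ⊥-elim (<-irrefl (φ-rank-injective nv nu (P.sym φu≡φv)) (rank-mono-< nv v<u))

  ∉X⇒rep⊎nonRep : ∀ {u} → inX X u ≡ false → rep u ≡ true ⊎ nonRep u ≡ true
  ∉X⇒rep⊎nonRep {u} u∉X with ≡true⊎≡false (rep u)
  ... | inj₁ ru = inj₁ ru
  ... | inj₂ ¬ru = inj₂ (∧-intro {not (inX X u)} (≡false⇒not≡true u∉X) (≡false⇒not≡true ¬ru))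

  rep⇒¬nonRep : ∀ {u} → rep u ≡ true → nonRep u ≡ false
  rep⇒¬nonRep {u} ru = ≢true⇒≡false λ nu →
    ≡true⇒≢false ru (not≡true⇒≡false (proj₂ (∧-elim {not (inX X u)} nu)))

  φ-rep : ∀ {u} → rep u ≡ true → φ u ≡ F.zero
  φ-rep = φ-¬nonRep ∘ rep⇒¬nonRep

  φ≡zero⇒rep : ∀ {u} → inX X u ≡ false → φ u ≡ F.zero → rep u ≡ true
  φ≡zero⇒rep u∉X φu≡0 with ∉X⇒rep⊎nonRep u∉X
  ... | inj₁ ru = ru
  ... | inj₂ nu = ⊥-elim (φ-nonRep-≢zero nu φu≡0)

  φ≢zero⇒nonRep : ∀ {u} → inX X u ≡ false → φ u ≢ F.zero → nonRep u ≡ true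
  φ≢zero⇒nonRep u∉X φu≢0 with ∉X⇒rep⊎nonRep u∉X
  ... | inj₁ ru = ⊥-elim (φu≢0 (φ-rep ru))
  ... | inj₂ nu = nu

  ¬adjMinus-reps : ∀ {u v} → adjMinus G X u v ≡ true → rep u ≡ true → rep v ≡ true → ⊥
  ¬adjMinus-reps {u} uv ru rv with rep-unique ru rv (adjMinus⇒connected uv)
  ... | refl = ≡true⇒≢false (adjMinus⇒adj uv) (irrefl G u)

  -- Two edges of G - X with the same image share their non-representative end; their
  -- representative ends are then in one component, hence equal.

  φ×φ-injective : ∀ u v u' v' → adjMinus G X u v ≡ true → adjMinus G X u' v' ≡ true →
    φ u ≡ φ u' → φ v ≡ φ v' → u ≡ u' × v ≡ v'
  φ×φ-injective u v u' v' uv u'v' φu≡φu' φv≡φv'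
    with ∉X⇒rep⊎nonRep (proj₁ (adjMinus⇒∉X uv)) | ∉X⇒rep⊎nonRep (proj₂ (adjMinus⇒∉X uv))
  ... | inj₁ ru | inj₁ rv = ⊥-elim (¬adjMinus-reps uv ru rv)
  ... | inj₁ ru | inj₂ nv with φ-injective nv φv≡φv'
  ... | refl = rep-unique ru ru' (connected-trans (adjMinus⇒connected uv) (connected-sym (adjMinus⇒connected u'v'))) , refl
    where
    ru' : rep u' ≡ true
    ru' = φ≡zero⇒rep (proj₁ (adjMinus⇒∉X u'v')) (P.trans (P.sym φu≡φu') (φ-rep ru))
  φ×φ-injective u v u' v' uv u'v' φu≡φu' φv≡φv' | inj₂ nu | _ with φ-injective nu φu≡φu'
  φ×φ-injective u v u' v' uv u'v' φu≡φu' φv≡φv' | inj₂ nu | inj₂ nv | refl = refl , φ-injective nv φv≡φv'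
  φ×φ-injective u v u' v' uv u'v' φu≡φu' φv≡φv' | inj₂ nu | inj₁ rv | refl =
    refl , rep-unique rv rv' (connected-trans (connected-sym (adjMinus⇒connected uv)) (adjMinus⇒connected u'v'))
    where
    rv' : rep v' ≡ true
    rv' = φ≡zero⇒rep (proj₂ (adjMinus⇒∉X u'v')) (P.trans (P.sym φv≡φv') (φ-rep rv))

  adjH : Fin (suc m) → Fin (suc m) → Bool
  adjH a b = anyF λ u → anyF λ v → eqF (φ u) a ∧ (eqF (φ v) b ∧ adjMinus G X u v)

  adjH-intro : ∀ {u v} → adjMinus G X u v ≡ true → adjH (φ u) (φ v) ≡ true
  adjH-intro {u} {v} uv =
    anyF-intro _ u (anyF-intro _ v (∧-intro (≡⇒eqF≡true {i = φ u} refl) (∧-intro (≡⇒eqF≡true {i = φ v} refl) uv)))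

  Preimage : Fin (suc m) → Fin (suc m) → Set
  Preimage a b = Σ (Fin n) λ u → Σ (Fin n) λ v → φ u ≡ a × φ v ≡ b × adjMinus G X u v ≡ true

  adjH-elim : ∀ {a b} → adjH a b ≡ true → Preimage a b
  adjH-elim e with anyF-elim _ e
  ... | u , q with anyF-elim _ q
  ... | v , r with ∧-elim r
  ... | φu≡a , r' with ∧-elim r'
  ... | φv≡b , uv = u , v , eqF≡true⇒≡ φu≡a , eqF≡true⇒≡ φv≡b , uv

  adjH-sym : ∀ a b → adjH a b ≡ adjH b a
  adjH-sym a b = bool-ext (flip a b) (flip b a)
    where
    flip : ∀ a b → adjH a b ≡ true → adjH b a ≡ true
    flip a b e with adjH-elim e
    ... | u , v , refl , refl , uv = adjH-intro (P.trans (adjMinus-sym v u) uv)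

  adjH-irrefl : ∀ a → adjH a a ≡ false
  adjH-irrefl a = ≢true⇒≡false λ e →
    let u , v , φu≡a , φv≡a , uv = adjH-elim e
        u≡v , _ = φ×φ-injective u v v u uv (P.trans (adjMinus-sym v u) uv) (P.trans φu≡a (P.sym φv≡a))
                                 (P.trans φv≡a (P.sym φu≡a))
    in ≡true⇒≢false (adjMinus⇒adj uv) (P.trans (cong (λ w → adj G w v) u≡v) (irrefl G v))

  H : Graph (suc m)
  H = record { adj = adjH ; sym = adjH-sym ; irrefl = adjH-irrefl }

  count₂-adjMinus≤2*edges-H : count₂ (adjMinus G X) ≤ 2 * edges H
  count₂-adjMinus≤2*edges-H = ≤-trans
    (count₂-mono-injective (adjMinus G X) adjH (λ u _ → φ u) (λ _ v → φ v) (λ _ _ → adjH-intro) φ×φ-injective)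
    (≤-reflexive (count₂-adj≡2*edges H))

  module Lift {p q : ℕ} (f : Fin (suc (suc p)) → Fin (suc m)) (g : Fin (suc q) → Fin (suc m))
              (f-inj : ∀ a a' → f a ≡ f a' → a ≡ a') (g-inj : ∀ b b' → g b ≡ g b' → b ≡ b')
              (f≢g : ∀ a b → f a ≢ g b) (f~g : ∀ a b → adjH (f a) (g b) ≡ true)
              (g≢zero : ∀ b → g b ≢ F.zero) where

    edge : ∀ a b → Preimage (f a) (g b)
    edge a b = adjH-elim (f~g a b)

    right : Fin (suc q) → Fin n
    right b = proj₁ (proj₂ (edge F.zero b))

    φ-right : ∀ b → φ (right b) ≡ g b
    φ-right b = proj₁ (proj₂ (proj₂ (proj₂ (edge F.zero b))))

    nonRep-right : ∀ b → nonRep (right b) ≡ true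
    nonRep-right b = φ≢zero⇒nonRep (proj₂ (adjMinus⇒∉X (proj₂ (proj₂ (proj₂ (proj₂ (edge F.zero b)))))))
                                   (λ φ≡0 → g≢zero b (P.trans (P.sym (φ-right b)) φ≡0))

    φ≡g⇒right : ∀ b {v} → φ v ≡ g b → v ≡ right b
    φ≡g⇒right b φv≡gb = P.sym (φ-injective (nonRep-right b) (P.trans (φ-right b) (P.sym φv≡gb)))

    left : Fin (suc (suc p)) → Fin n
    left a = proj₁ (edge a F.zero)

    φ-left : ∀ a → φ (left a) ≡ f a
    φ-left a = proj₁ (proj₂ (proj₂ (edge a F.zero)))

    partner : Fin (suc (suc p)) → Fin n
    partner a = proj₁ (proj₂ (edge a F.zero))

    φ-partner : ∀ a → φ (partner a) ≡ g F.zero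
    φ-partner a = proj₁ (proj₂ (proj₂ (proj₂ (edge a F.zero))))

    left~partner : ∀ a → adjMinus G X (left a) (partner a) ≡ true
    left~partner a = proj₂ (proj₂ (proj₂ (proj₂ (edge a F.zero))))

    left∉X : ∀ a → inX X (left a) ≡ false
    left∉X a = proj₁ (adjMinus⇒∉X (left~partner a))

    left~right₀ : ∀ a → connected G X (left a) (right F.zero) ≡ true
    left~right₀ a = subst (λ y → connected G X (left a) y ≡ true) (φ≡g⇒right F.zero (φ-partner a))
                          (adjMinus⇒connected (left~partner a))

    left~right-nonzero : ∀ a b → f a ≢ F.zero → adjMinus G X (left a) (right b) ≡ true
    left~right-nonzero a b fa≢0 with edge a b
    ... | u , v , φu≡fa , φv≡gb , uv = P.subst₂ (λ x y → adjMinus G X x y ≡ true) u≡left (φ≡g⇒right b φv≡gb) uv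
      where
      nonRep-left : nonRep (left a) ≡ true
      nonRep-left = φ≢zero⇒nonRep (left∉X a) (λ φ≡0 → fa≢0 (P.trans (P.sym (φ-left a)) φ≡0))
      u≡left : u ≡ left a
      u≡left = P.sym (φ-injective nonRep-left (P.trans (φ-left a) (P.sym φu≡fa)))

    another : (a : Fin (suc (suc p))) → Σ (Fin (suc (suc p))) λ a' → a' ≢ a
    another F.zero = F.suc F.zero , λ ()
    another (F.suc a) = F.zero , λ ()

    -- When f a = 0, left a and the left end u of a preimage of (f a, g b) are representatives;
    -- they are connected through right b, left a', right 0 for any a' ≠ a, so u = left a.

    left~right : ∀ a b → adjMinus G X (left a) (right b) ≡ true
    left~right a b with f a F.≟ F.zero
    ... | no fa≢0 = left~right-nonzero a b fa≢0
    ... | yes fa≡0 with another a | edge a b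
    ... | a' , a'≢a | u , v , φu≡fa , φv≡gb , uv =
      P.subst₂ (λ x y → adjMinus G X x y ≡ true) (rep-unique ru rep-left u~left) v≡right uv
      where
      v≡right : v ≡ right b
      v≡right = φ≡g⇒right b φv≡gb
      fa'≢0 : f a' ≢ F.zero
      fa'≢0 fa'≡0 = a'≢a (f-inj a' a (P.trans fa'≡0 (P.sym fa≡0)))
      ru : rep u ≡ true
      ru = φ≡zero⇒rep (proj₁ (adjMinus⇒∉X uv)) (P.trans φu≡fa fa≡0)
      rep-left : rep (left a) ≡ true
      rep-left = φ≡zero⇒rep (left∉X a) (P.trans (φ-left a) fa≡0)
      u~left : connected G X u (left a) ≡ true
      u~left = connected-trans (subst (λ y → connected G X u y ≡ true) v≡right (adjMinus⇒connected uv))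
              (connected-trans (connected-sym (adjMinus⇒connected (left~right-nonzero a' b fa'≢0)))
              (connected-trans (adjMinus⇒connected (left~right-nonzero a' F.zero fa'≢0))
                               (connected-sym (left~right₀ a))))

    lifted : ContainsK (suc (suc p)) (suc q) G
    lifted = left , right ,
      (λ a a' e → f-inj a a' (P.trans (P.sym (φ-left a)) (P.trans (cong φ e) (φ-left a')))) ,
      (λ b b' e → g-inj b b' (P.trans (P.sym (φ-right b)) (P.trans (cong φ e) (φ-right b')))) ,
      (λ a b e → f≢g a b (P.trans (P.sym (φ-left a)) (P.trans (cong φ e) (φ-right b)))) ,
      (λ a b → adjMinus⇒adj (left~right a b))

  -- At most one side of a biclique in H can contain 0; lift with that side on the left.

  liftK : ∀ {l t} → 2 ≤ l → 2 ≤ t → ContainsK l t H → ContainsK l t G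
  liftK {suc (suc _)} {suc (suc _)} (s≤s (s≤s _)) (s≤s (s≤s _)) (f , g , f-inj , g-inj , f≢g , f~g)
    with any? (λ b → g b F.≟ F.zero)
  ... | no g≢0 = Lift.lifted f g f-inj g-inj f≢g f~g (λ b gb≡0 → g≢0 (b , gb≡0))
  ... | yes (b₀ , gb₀≡0) = swapK {G = G} (Lift.lifted g f g-inj f-inj (λ b a e → f≢g a b (P.sym e))
                                    (λ b a → P.trans (adjH-sym (g b) (f a)) (f~g a b))
                                    (λ a fa≡0 → f≢g a b₀ (P.trans fa≡0 (P.sym gb₀≡0))))

compress : ∀ {n} (G : Graph n) (X : Subset n) m → 2 * halfSum G X ≤ m →
  Σ (Graph (suc m)) λ H →
    (2 * edges G ≤ ∣ X ∣ * (n ∸ 1) + (n ∸ ∣ X ∣) * ∣ X ∣ + 2 * edges H) ×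
    (∀ {l t} → 2 ≤ l → 2 ≤ t → ContainsK l t H → ContainsK l t G)
compress G X m 2*halfSum≤m = H , ≤-trans (2*edges≤ G X) (+-monoʳ-≤ _ count₂-adjMinus≤2*edges-H) , liftK
  where
  open Compression G X m (≤-trans (Representatives.count-nonRep≤2*halfSum G X) 2*halfSum≤m)

halfSum≤s∸∣X∣ : ∀ {n s} (G : Graph n) (X : Subset n) → InScrX s G X → halfSum G X ≤ s ∸ ∣ X ∣
halfSum≤s∸∣X∣ {s = s} G X X∈𝒳 = m+n≤o⇒m≤o∸n (halfSum G X) (subst (_≤ s) (+-comm ∣ X ∣ _) X∈𝒳)

2*edges≤n*n : ∀ {n} (G : Graph n) → 2 * edges G ≤ n * n
2*edges≤n*n G = subst (_≤ _) (count₂-adj≡2*edges G) (count₂≤ (adj G))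

ex-bound : ∀ {m m' l t e} → m ≡ m' → IsExK m l t e → (H : Graph m') → ¬ ContainsK l t H → edges H ≤ e
ex-bound refl (_ , maximal) = maximal

2*⌊n/2⌋≤n : ∀ n → 2 * ⌊ n /2⌋ ≤ n
2*⌊n/2⌋≤n n = begin
  2 * ⌊ n /2⌋             ≡⟨ cong (⌊ n /2⌋ +_) (+-identityʳ ⌊ n /2⌋) ⟩
  ⌊ n /2⌋ + ⌊ n /2⌋       ≤⟨ +-monoʳ-≤ ⌊ n /2⌋ (⌊n/2⌋≤⌈n/2⌉ n) ⟩
  ⌊ n /2⌋ + ⌈ n /2⌉       ≡⟨ ⌊n/2⌋+⌈n/2⌉≡n n ⟩
  n                       ∎
  where open ≤-Reasoning

m∸[n∸1]≡m∸n+1 : ∀ {m n} → 1 ≤ n → n ≤ m → m ∸ (n ∸ 1) ≡ m ∸ n + 1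
m∸[n∸1]≡m∸n+1 {suc m} {suc zero} _ _ = +-comm 1 m
m∸[n∸1]≡m∸n+1 {suc m} {suc (suc n)} _ (s≤s n<m) = m∸[n∸1]≡m∸n+1 (s≤s z≤n) n<m

2*[mC2]+m≡m*m : ∀ m → 2 * (m C 2) + m ≡ m * m
2*[mC2]+m≡m*m zero = refl
2*[mC2]+m≡m*m (suc m) = begin
    2 * (suc m C 2) + suc m       ≡⟨ cong (λ z → 2 * z + suc m) (P.sym (nCk+nC[k+1]≡[n+1]C[k+1] m 1)) ⟩
    2 * (m C 1 + m C 2) + suc m   ≡⟨ cong (λ z → 2 * (z + m C 2) + suc m) (nC1≡n m) ⟩
    2 * (m + m C 2) + suc m       ≡⟨ regroup m (m C 2) ⟩
    (2 * (m C 2) + m) + (2 * m + 1) ≡⟨ cong (_+ (2 * m + 1)) (2*[mC2]+m≡m*m m) ⟩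
    m * m + (2 * m + 1)           ≡⟨ square-suc m ⟩
    suc m * suc m                 ∎
  where
  open P.≡-Reasoning
  regroup : ∀ m c → 2 * (m + c) + suc m ≡ (2 * c + m) + (2 * m + 1)
  regroup = solve-∀
  square-suc : ∀ m → m * m + (2 * m + 1) ≡ suc m * suc m
  square-suc = solve-∀

-- 2 * (3s choose 2) = 9s² - 3s, which dominates 5s² + 4s + 1 = (2s + 1)² + s² once s ≥ 1.

large-n⇒square-bound : ∀ {s n} → 1 ≤ s → 2 * ((3 * s) C 2) ≤ n → suc (2 * s) * suc (2 * s) + s * s ≤ 2 * n
large-n⇒square-bound {suc u} {n} _ n-large = +-cancelʳ-≤ (6 * s) _ _ (begin
    suc (2 * s) * suc (2 * s) + s * s + 6 * s         ≤⟨ m≤m+n _ (13 * u * u + 16 * u + 2) ⟩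
    suc (2 * s) * suc (2 * s) + s * s + 6 * s + (13 * u * u + 16 * u + 2)
                                                       ≡⟨ expand u ⟩
    2 * (3 * s * (3 * s))                              ≡⟨ cong (2 *_) (P.sym (2*[mC2]+m≡m*m (3 * s))) ⟩
    2 * (2 * ((3 * s) C 2) + 3 * s)                    ≡⟨ distribute ((3 * s) C 2) s ⟩
    2 * (2 * ((3 * s) C 2)) + 6 * s                    ≤⟨ +-monoˡ-≤ (6 * s) (*-monoʳ-≤ 2 n-large) ⟩
    2 * n + 6 * s                                      ∎)
  where
  open ≤-Reasoning
  s = suc u
  expand : ∀ u → suc (2 * suc u) * suc (2 * suc u) + suc u * suc u + 6 * suc u + (13 * u * u + 16 * u + 2)
                 ≡ 2 * (3 * suc u * (3 * suc u))
  expand = solve-∀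
  distribute : ∀ c s → 2 * (2 * c + 3 * s) ≡ 2 * (2 * c) + 6 * s
  distribute = solve-∀

large-n⇒s≤n : ∀ {s n} → 1 ≤ s → 2 * ((3 * s) C 2) ≤ n → s ≤ n
large-n⇒s≤n {s} {n} 1≤s n-large = *-cancelˡ-≤ 2 (begin
  2 * s                                           ≤⟨ m≤m+n (2 * s) (5 * (s * s) + 2 * s + 1) ⟩
  2 * s + (5 * (s * s) + 2 * s + 1)               ≡⟨ expand s ⟩
  suc (2 * s) * suc (2 * s) + s * s               ≤⟨ large-n⇒square-bound 1≤s n-large ⟩
  2 * n                                           ∎)
  where
  open ≤-Reasoning
  expand : ∀ s → 2 * s + (5 * (s * s) + 2 * s + 1) ≡ suc (2 * s) * suc (2 * s) + s * s
  expand = solve-∀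

degree-sum-identity : ∀ {L n} → L ≤ n → L * (n ∸ 1) + (n ∸ L) * L + suc L * L ≡ 2 * (L * n)
degree-sum-identity {zero} {n} _ = P.trans (+-identityʳ (n * 0)) (*-zeroʳ n)
degree-sum-identity {suc L} {n} L<n with m≤n⇒∃[o]m+o≡n L<n
... | r , refl = P.trans (cong (λ z → suc L * (L + r) + z * suc L + suc (suc L) * suc L) (m+n∸m≡n (suc L) r))
                         (identity L r)
  where
  identity : ∀ L r → suc L * (L + r) + r * suc L + suc (suc L) * suc L ≡ 2 * (suc L * (suc L + r))
  identity = solve-∀

bound-when-x≡l-1 : ∀ {l n e E} → 1 ≤ l → l ∸ 1 ≤ n →
  2 * e ≤ (l ∸ 1) * (n ∸ 1) + (n ∸ (l ∸ 1)) * (l ∸ 1) + 2 * E →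
  e + ⌊ l * (l ∸ 1) /2⌋ ≤ (l ∸ 1) * n + E
bound-when-x≡l-1 {suc L} {n} {e} {E} _ L≤n 2e≤ = *-cancelˡ-≤ 2 (begin
  2 * (e + ⌊ suc L * L /2⌋)                              ≡⟨ *-distribˡ-+ 2 e _ ⟩
  2 * e + 2 * ⌊ suc L * L /2⌋                            ≤⟨ +-mono-≤ 2e≤ (2*⌊n/2⌋≤n (suc L * L)) ⟩
  L * (n ∸ 1) + (n ∸ L) * L + 2 * E + suc L * L          ≡⟨ xy∙z≈xz∙y (L * (n ∸ 1) + (n ∸ L) * L) (2 * E) _ ⟩
  L * (n ∸ 1) + (n ∸ L) * L + suc L * L + 2 * E          ≡⟨ cong (_+ 2 * E) (degree-sum-identity L≤n) ⟩
  2 * (L * n) + 2 * E                                    ≡⟨ P.sym (*-distribˡ-+ 2 (L * n) E) ⟩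
  2 * (L * n + E)                                        ∎)
  where open ≤-Reasoning

bound-when-x<l-1 : ∀ {l s n x e E} → suc x ≤ l ∸ 1 → l ≤ s → 1 ≤ s → 2 * ((3 * s) C 2) ≤ n →
  2 * e ≤ x * (n ∸ 1) + (n ∸ x) * x + suc (2 * s) * suc (2 * s) →
  e + ⌊ l * (l ∸ 1) /2⌋ ≤ (l ∸ 1) * n + E
bound-when-x<l-1 {l} {s} {n} {x} {e} {E} x<l-1 l≤s 1≤s n-large 2e≤ = *-cancelˡ-≤ 2 (begin
  2 * (e + ⌊ l * (l ∸ 1) /2⌋)                                    ≡⟨ *-distribˡ-+ 2 e _ ⟩
  2 * e + 2 * ⌊ l * (l ∸ 1) /2⌋                                  ≤⟨ +-mono-≤ 2e≤ (2*⌊n/2⌋≤n (l * (l ∸ 1))) ⟩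
  x * (n ∸ 1) + (n ∸ x) * x + M + l * (l ∸ 1)                    ≤⟨ +-mono-≤ (+-monoˡ-≤ M (+-mono-≤
                                                                      (*-monoʳ-≤ x (m∸n≤m n 1)) (*-monoˡ-≤ x (m∸n≤m n x))))
                                                                      (*-mono-≤ l≤s (≤-trans (m∸n≤m l 1) l≤s)) ⟩
  x * n + n * x + M + s * s                                      ≡⟨ +-assoc (x * n + n * x) M (s * s) ⟩
  x * n + n * x + (M + s * s)                                    ≤⟨ +-monoʳ-≤ (x * n + n * x) (large-n⇒square-bound 1≤s n-large) ⟩
  x * n + n * x + 2 * n                                          ≡⟨ collect x n ⟩
  2 * (suc x * n)                                                ≤⟨ *-monoʳ-≤ 2 (*-monoˡ-≤ n x<l-1) ⟩
  2 * ((l ∸ 1) * n)                                              ≤⟨ *-monoʳ-≤ 2 (m≤m+n ((l ∸ 1) * n) E) ⟩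
  2 * ((l ∸ 1) * n + E)                                          ∎)
  where
  open ≤-Reasoning
  M : ℕ
  M = suc (2 * s) * suc (2 * s)
  collect : ∀ x n → x * n + n * x + 2 * n ≡ 2 * (suc x * n)
  collect = solve-∀

corollary3p3 : (l t s n : ℕ) → 2 ≤ l → l ≤ t → 3 ≤ l + 1 → l + 1 ≤ s →
    2 * ((3 * s) C 2) ≤ n →
    (x : ℕ) → 1 ≤ x → x ≤ l ∸ 1 →
    (exK : ℕ) → IsExK (2 * (s ∸ l + 1) + 1) l t exK →
    (G : Graph n) → InGx n l t s x G →
    edges G + ⌊ l * (l ∸ 1) /2⌋ ≤ (l ∸ 1) * n + exK
corollary3p3 l t s n 2≤l l≤t _ l+1≤s n-large _ _ x≤l-1 exK ex G (K-free , _ , (X , X∈𝒳 , refl) , _) =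
  [ whenSmall , whenCritical ] (m≤n⇒m<n∨m≡n x≤l-1)
  where
  1≤l : 1 ≤ l
  1≤l = m+n≤o⇒m≤o 1 2≤l
  l≤s : l ≤ s
  l≤s = m+n≤o⇒m≤o l l+1≤s
  1≤s : 1 ≤ s
  1≤s = ≤-trans 1≤l l≤s

  whenSmall : suc ∣ X ∣ ≤ l ∸ 1 → edges G + ⌊ l * (l ∸ 1) /2⌋ ≤ (l ∸ 1) * n + exK
  whenSmall x<l-1 =
    let H , 2e≤ , _ = compress G X (2 * s) (*-monoʳ-≤ 2 (≤-trans (halfSum≤s∸∣X∣ G X X∈𝒳) (m∸n≤m s ∣ X ∣)))
    in bound-when-x<l-1 x<l-1 l≤s 1≤s n-large (≤-trans 2e≤ (+-monoʳ-≤ _ (2*edges≤n*n H)))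

  whenCritical : ∣ X ∣ ≡ l ∸ 1 → edges G + ⌊ l * (l ∸ 1) /2⌋ ≤ (l ∸ 1) * n + exK
  whenCritical ∣X∣≡l-1 =
    let s∸∣X∣≡s∸l+1 = P.trans (cong (s ∸_) ∣X∣≡l-1) (m∸[n∸1]≡m∸n+1 1≤l l≤s)
        H , 2e≤ , liftK = compress G X (2 * (s ∸ l + 1))
                            (*-monoʳ-≤ 2 (subst (halfSum G X ≤_) s∸∣X∣≡s∸l+1 (halfSum≤s∸∣X∣ G X X∈𝒳)))
        edgesH≤exK = ex-bound (+-comm _ 1) ex H (K-free ∘ liftK 2≤l (≤-trans 2≤l l≤t))
    in bound-when-x≡l-1 1≤l (≤-trans (m∸n≤m l 1) (≤-trans l≤s (large-n⇒s≤n 1≤s n-large)))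
         (subst (λ k → 2 * edges G ≤ k * (n ∸ 1) + (n ∸ k) * k + 2 * exK) ∣X∣≡l-1
                (≤-trans 2e≤ (+-monoʳ-≤ (∣ X ∣ * (n ∸ 1) + (n ∸ ∣ X ∣) * ∣ X ∣) (*-monoʳ-≤ 2 edgesH≤exK))))
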